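{- Let $h:\mathbb N\to\mathbb N$ be strictly increasing, $\alpha<\varepsilon_0$ and $n>0$. If $\langle\alpha_0,n_0\rangle,\dots,\langle\alpha_\ell,n_\ell\rangle$ is a Hardy computation for $h^\alpha(n)$, then $|\alpha_i|\le G_\alpha(n_\ell)$ for all $0\le i\le\ell$.
   Context: Ordinals below $\varepsilon_0$ are denoted by terms in Cantor normal form $\omega^{\alpha_1}+\cdots+\omega^{\alpha_m}$ with $\alpha_1\ge\cdots\ge\alpha_m$. Term size: $|0|=0$, $|\omega^\alpha|=1+|\alpha|$, $|\alpha+\alpha'|=|\alpha|+|\alpha'|$. Limit ordinals have fundamental sequences $(\gamma+\omega^{\beta+1})(x)=\gamma+\omega^\beta\cdot(x+1)$, $(\gamma+\omega^{\lambda'})(x)=\gamma+\omega^{\lambda'(x)}$ for $\lambda'$ limit. Predecessor at $x$ of an ordinal $>0$: $P_x(\alpha+1)=\alpha$, $P_x(\lambda)=P_x(\lambda(x))$. Slow-growing hierarchy: $G_0(x)=0$, $G_{\alpha+1}(x)=1+G_\alpha(x)$, $G_\lambda(x)=G_{\lambda(x)}(x)$. Hardy functions: $h^0(x)=x$, $h^{\alpha+1}(x)=h^\alpha(h(x))$, $h^\lambda(x)=h^{\lambda(x)}(x)$. A Hardy computation for $h^\alpha(n)$ is a sequence of pairs $\langle\alpha_0,n_0\rangle,\dots,\langle\alpha_\ell,n_\ell\rangle$ with $\alpha_0=\alpha$, $n_0=n$, $\alpha_\ell=0$, and for each $0<i\le\ell$: $\alpha_i=P_{n_{i-1}}(\alpha_{i-1})$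 and $n_i=h(n_{i-1})$. -}

module Defs where

open import Data.Nat using (ℕ; zero; suc; _+_; _≤_; _<_)
open import Data.Sum using (_⊎_)
open import Relation.Binary.PropositionalEquality using (_≡_)

-- Ordinal terms below ε₀:  `ω^ a + b`  denotes  ω^a + b.
-- A term in Cantor normal form ω^{α₁}+⋯+ω^{αₘ} is  ω^ α₁ + (ω^ α₂ + ( ⋯ + (ω^ αₘ + 𝟎))).
data Tm : Set where
  𝟎    : Tm
  ω^_+_ : Tm → Tm → Tm

data _<ₒ_ : Tm → Tm → Set where
  0<   : ∀ {a b} → 𝟎 <ₒ (ω^ a + b)
  <hd  : ∀ {a b c d} → a <ₒ c → (ω^ a + b) <ₒ (ω^ c + d)
  <tl  : ∀ {a b d} → b <ₒ d → (ω^ a + b) <ₒ (ω^ a + d)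

data HeadLE (a : Tm) : Tm → Set where
  hz  : HeadLE a 𝟎
  hle : ∀ {c d} → (c <ₒ a) ⊎ (c ≡ a) → HeadLE a (ω^ c + d)

data NF : Tm → Set where
  nf0 : NF 𝟎
  nfω : ∀ {a b} → NF a → NF b → HeadLE a b → NF (ω^ a + b)

-- term size: |0| = 0, |ω^α| = 1 + |α|, |α + α'| = |α| + |α'|
size : Tm → ℕ
size 𝟎 = 0
size (ω^ a + b) = suc (size a) + size b

data Kind : Set where
  isZ   : Kind
  isSuc : Tm → Kind
  isLim : Kind

kind : Tm → Kind
kind 𝟎 = isZ
kind (ω^ 𝟎 + 𝟎) = isSuc 𝟎
kind (ω^ (ω^ _ + _) + 𝟎) = isLim
kind (ω^ a + (ω^ c + d)) with kind (ω^ c + d)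
... | isSuc β = isSuc (ω^ a + β)
... | _ = isLim

rep : Tm → ℕ → Tm → Tm
rep β zero t = t
rep β (suc k) t = ω^ β + rep β k t

-- fundamental sequences (only meaningful for limit terms):
--  (γ + ω^{β+1})(x) = γ + ω^β·(x+1),  (γ + ω^λ)(x) = γ + ω^{λ(x)}
fs : Tm → ℕ → Tm
fs 𝟎 x = 𝟎
fs (ω^ a + 𝟎) x with kind a
... | isZ = 𝟎
... | isSuc β = rep β (suc x) 𝟎
... | isLim = ω^ (fs a x) + 𝟎
fs (ω^ a + (ω^ c + d)) x = ω^ a + fs (ω^ c + d) x

-- Pred x α β :  P_x(α) = β   (P_x(α+1) = α,  P_x(λ) = P_x(λ(x)))
data Pred (x : ℕ) : Tm → Tm → Set where
  pSuc : ∀ {α β} → kind α ≡ isSuc β → Pred x α β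
  pLim : ∀ {α β} → kind α ≡ isLim → Pred x (fs α x) β → Pred x α β

-- SlowG α x m :  G_α(x) = m
--   G_0(x) = 0,  G_{α+1}(x) = 1 + G_α(x),  G_λ(x) = G_{λ(x)}(x)
data SlowG : Tm → ℕ → ℕ → Set where
  g0   : ∀ {x} → SlowG 𝟎 x 0
  gSuc : ∀ {α β x m} → kind α ≡ isSuc β → SlowG β x m → SlowG α x (suc m)
  gLim : ∀ {α x m} → kind α ≡ isLim → SlowG (fs α x) x m → SlowG α x m

-- A Hardy computation for h^α(n) of length ℓ, given as sequences αs, ns indexed by 0..ℓ
record HardyComp (h : ℕ → ℕ) (α : Tm) (n : ℕ) (ℓ : ℕ) (αs : ℕ → Tm) (ns : ℕ → ℕ) : Set where
  field
    start-α : αs 0 ≡ α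
    start-n : ns 0 ≡ n
    end-α   : αs ℓ ≡ 𝟎
    step-α  : ∀ i → i < ℓ → Pred (ns i) (αs i) (αs (suc i))
    step-n  : ∀ i → i < ℓ → ns (suc i) ≡ h (ns i)

StrictlyIncreasing : (ℕ → ℕ) → Set
StrictlyIncreasing h = ∀ {x y} → x < y → h x < h y

-- G_α(y) has the closed form  G(ω^a + b)(y) = (y+1)^{G_a(y)} + G_b(y).  For x ≤ y, passing to the
-- fundamental sequence λ(x) does not increase this value at y (with equality at x = y), so every
-- predecessor step P_x with x ≤ y lowers it strictly.  Along a Hardy computation the arguments n_i
-- grow, hence all are ≤ n_ℓ and G_{α_i}(n_ℓ) ≤ G_α(n_ℓ).  Finally |α| ≤ G_α(y) whenever y ≥ 1,
-- since 1 + k ≤ (y+1)^k.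
module Submission where

open import Defs
open import Data.Nat using (ℕ; zero; suc; _+_; _*_; _^_; _≤_; _<_; _≥_; z≤n; s≤s)
open import Data.Nat.Properties
open import Data.Empty using (⊥-elim)
open import Data.Product using (∃-syntax; _,_)
open import Data.Sum using (_⊎_; inj₁; inj₂; [_,_]′)
open import Relation.Binary.Core using (Rel)
open import Relation.Binary.Definitions using (Reflexive; Transitive)
open import Relation.Binary.PropositionalEquality
open import Relation.Nullary using (¬_)

G : Tm → ℕ → ℕ
G 𝟎 y = 0
G (ω^ a + b) y = suc y ^ G a y + G b y

consKind : Tm → Kind → Kind
consKind a (isSuc β) = isSuc (ω^ a + β)
consKind a _ = isLim

kind-cons : ∀ a c d → kind (ω^ a + (ω^ c + d)) ≡ consKind a (kind (ω^ c + d))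
kind-cons 𝟎 c d with kind (ω^ c + d)
... | isZ = refl
... | isSuc _ = refl
... | isLim = refl
kind-cons (ω^ _ + _) c d with kind (ω^ c + d)
... | isZ = refl
... | isSuc _ = refl
... | isLim = refl

kind-ω^≢isZ : ∀ c d → ¬ kind (ω^ c + d) ≡ isZ
kind-ω^≢isZ 𝟎 𝟎 ()
kind-ω^≢isZ (ω^ _ + _) 𝟎 ()
kind-ω^≢isZ c (ω^ c′ + d′) eq with kind (ω^ c′ + d′) | trans (sym (kind-cons c c′ d′)) eq
... | isZ | ()
... | isSuc _ | ()
... | isLim | ()

data Succ : Tm → Tm → Set where
  one  : Succ (ω^ 𝟎 + 𝟎) 𝟎
  _+ₛ_ : ∀ {c d β} a → Succ (ω^ c + d) β → Succ (ω^ a + (ω^ c + d)) (ω^ a + β)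

succView : ∀ α {β} → kind α ≡ isSuc β → Succ α β
succView (ω^ 𝟎 + 𝟎) refl = one
succView (ω^ a + t@(ω^ c + d)) eq with kind t in k | trans (sym (kind-cons a c d)) eq
... | isSuc _ | refl = a +ₛ succView t k

data Limit : Tm → Set where
  ω^suc : ∀ {a β} → kind a ≡ isSuc β → Limit (ω^ a + 𝟎)
  ω^lim : ∀ {a} → kind a ≡ isLim → Limit a → Limit (ω^ a + 𝟎)
  _+ₗ_  : ∀ {c d} a → Limit (ω^ c + d) → Limit (ω^ a + (ω^ c + d))

kind-ω^-suc⊎lim : ∀ c d → (∃[ β ] kind (ω^ c + d) ≡ isSuc β) ⊎ kind (ω^ c + d) ≡ isLim
kind-ω^-suc⊎lim c d with kind (ω^ c + d) in k
... | isZ = ⊥-elim (kind-ω^≢isZ c d k)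
... | isSuc β = inj₁ (β , refl)
... | isLim = inj₂ refl

kind-cons-isLim : ∀ a c d → kind (ω^ a + (ω^ c + d)) ≡ isLim → kind (ω^ c + d) ≡ isLim
kind-cons-isLim a c d eq with kind (ω^ c + d) in k | trans (sym (kind-cons a c d)) eq
... | isZ | _ = ⊥-elim (kind-ω^≢isZ c d k)
... | isLim | _ = refl

limitView : ∀ l → kind l ≡ isLim → Limit l
limitView (ω^ (ω^ p + q) + 𝟎) _ =
  [ (λ (_ , k) → ω^suc k) , (λ k → ω^lim k (limitView (ω^ p + q) k)) ]′ (kind-ω^-suc⊎lim p q)
limitView (ω^ a + (ω^ c + d)) eq = a +ₗ limitView (ω^ c + d) (kind-cons-isLim a c d eq)

fs-ω^-suc : ∀ a {β} x → kind a ≡ isSuc β → fs (ω^ a + 𝟎) x ≡ rep β (suc x) 𝟎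
fs-ω^-suc a x k rewrite k = refl

fs-ω^-lim : ∀ a x → kind a ≡ isLim → fs (ω^ a + 𝟎) x ≡ ω^ fs a x + 𝟎
fs-ω^-lim a x k rewrite k = refl

G-suc : ∀ α {β} y → kind α ≡ isSuc β → G α y ≡ suc (G β y)
G-suc α y k = go (succView α k)
  where
    go : ∀ {α β} → Succ α β → G α y ≡ suc (G β y)
    go one = refl
    go (a +ₛ s) = trans (cong (suc y ^ G a y +_) (go s)) (+-suc _ _)

G-rep : ∀ β k y → G (rep β k 𝟎) y ≡ k * suc y ^ G β y
G-rep β zero y = refl
G-rep β (suc k) y = cong (suc y ^ G β y +_) (G-rep β k y)

G-ω^-suc : ∀ a β y → kind a ≡ isSuc β → G (ω^ a + 𝟎) y ≡ suc y * suc y ^ G β y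
G-ω^-suc a β y k = begin
  suc y ^ G a y + 0        ≡⟨ +-identityʳ _ ⟩
  suc y ^ G a y            ≡⟨ cong (suc y ^_) (G-suc a y k) ⟩
  suc y * suc y ^ G β y    ∎
  where open ≡-Reasoning

G-fs-≤ : ∀ {l x y} → Limit l → x ≤ y → G (fs l x) y ≤ G l y
G-fs-≤ {x = x} {y} (ω^suc {a} {β} k) x≤y = begin
  G (fs (ω^ a + 𝟎) x) y    ≡⟨ cong (λ t → G t y) (fs-ω^-suc a x k) ⟩
  G (rep β (suc x) 𝟎) y    ≡⟨ G-rep β (suc x) y ⟩
  suc x * suc y ^ G β y    ≤⟨ *-monoˡ-≤ _ (s≤s x≤y) ⟩
  suc y * suc y ^ G β y    ≡⟨ G-ω^-suc a β y k ⟨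
  G (ω^ a + 𝟎) y           ∎
  where open ≤-Reasoning
G-fs-≤ {x = x} {y} (ω^lim {a} k l) x≤y = begin
  G (fs (ω^ a + 𝟎) x) y    ≡⟨ cong (λ t → G t y) (fs-ω^-lim a x k) ⟩
  G (ω^ fs a x + 𝟎) y      ≤⟨ +-monoˡ-≤ 0 (^-monoʳ-≤ (suc y) (G-fs-≤ l x≤y)) ⟩
  G (ω^ a + 𝟎) y           ∎
  where open ≤-Reasoning
G-fs-≤ {y = y} (a +ₗ l) x≤y = +-monoʳ-≤ (suc y ^ G a y) (G-fs-≤ l x≤y)

G-fs-diag : ∀ {l} y → Limit l → G (fs l y) y ≡ G l y
G-fs-diag y (ω^suc {a} {β} k) = begin
  G (fs (ω^ a + 𝟎) y) y    ≡⟨ cong (λ t → G t y) (fs-ω^-suc a y k) ⟩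
  G (rep β (suc y) 𝟎) y    ≡⟨ G-rep β (suc y) y ⟩
  suc y * suc y ^ G β y    ≡⟨ G-ω^-suc a β y k ⟨
  G (ω^ a + 𝟎) y           ∎
  where open ≡-Reasoning
G-fs-diag y (ω^lim {a} k l) = begin
  G (fs (ω^ a + 𝟎) y) y    ≡⟨ cong (λ t → G t y) (fs-ω^-lim a y k) ⟩
  G (ω^ fs a y + 𝟎) y      ≡⟨ cong (λ e → suc y ^ e + 0) (G-fs-diag y l) ⟩
  G (ω^ a + 𝟎) y           ∎
  where open ≡-Reasoning
G-fs-diag y (a +ₗ l) = cong (suc y ^ G a y +_) (G-fs-diag y l)

SlowG⇒≡G : ∀ {α y m} → SlowG α y m → m ≡ G α y
SlowG⇒≡G g0 = refl
SlowG⇒≡G {α} {y} (gSuc k s) = trans (cong suc (SlowG⇒≡G s)) (sym (G-suc α y k))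
SlowG⇒≡G {α} {y} (gLim k s) = trans (SlowG⇒≡G s) (G-fs-diag y (limitView α k))

Pred⇒G< : ∀ {x α β y} → Pred x α β → x ≤ y → G β y < G α y
Pred⇒G< {α = α} {y = y} (pSuc k) _ = ≤-reflexive (sym (G-suc α y k))
Pred⇒G< {α = α} (pLim k p) x≤y = <-≤-trans (Pred⇒G< p x≤y) (G-fs-≤ (limitView α k) x≤y)

n<m^n : ∀ m → 1 < m → ∀ n → n < m ^ n
n<m^n (suc _) _ zero = s≤s z≤n
n<m^n m 1<m (suc n) = ≤-<-trans (n<m^n m 1<m n) (^-monoʳ-< m 1<m (n<1+n n))

size≤G : ∀ α {y} → 0 < y → size α ≤ G α y
size≤G 𝟎 _ = z≤n
size≤G (ω^ a + b) {suc y} 0<y =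
  +-mono-≤ (≤-trans (s≤s (size≤G a 0<y)) (n<m^n (suc (suc y)) (s≤s (s≤s z≤n)) (G a (suc y))))
           (size≤G b 0<y)

strictlyIncreasing⇒inflationary : ∀ {h} → StrictlyIncreasing h → ∀ x → x ≤ h x
strictlyIncreasing⇒inflationary si zero = z≤n
strictlyIncreasing⇒inflationary si (suc x) =
  ≤-<-trans (strictlyIncreasing⇒inflationary si x) (si (n<1+n x))

steps⇒chain : ∀ {a r} {A : Set a} {R : Rel A r} → Reflexive R → Transitive R →
              (f : ℕ → A) {n : ℕ} → (∀ k → k < n → R (f k) (f (suc k))) →
              ∀ {i j} → i ≤ j → j ≤ n → R (f i) (f j)
steps⇒chain R-refl R-trans f step {j = zero} z≤n _ = R-refl
steps⇒chain {R = R} R-refl R-trans f step {j = suc j} i≤1+j j<n with m≤n⇒m<n∨m≡n i≤1+j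
... | inj₂ refl = R-refl
... | inj₁ (s≤s i≤j) = R-trans (steps⇒chain {R = R} R-refl R-trans f step i≤j (<⇒≤ j<n)) (step j j<n)

lemmaA9 : (h : ℕ → ℕ) → StrictlyIncreasing h →
          (α : Tm) → NF α → (n : ℕ) → 0 < n →
          (ℓ : ℕ) (αs : ℕ → Tm) (ns : ℕ → ℕ) → HardyComp h α n ℓ αs ns →
          ∀ i → i ≤ ℓ → ∀ m → SlowG α (ns ℓ) m → size (αs i) ≤ m
-- The bound holds for arbitrary terms.
lemmaA9 h si α _ n 0<n ℓ αs ns hc i i≤ℓ m Gα = begin
  size (αs i)      ≤⟨ size≤G (αs i) 0<y ⟩
  G (αs i) y       ≤⟨ steps⇒chain {R = _≥_} ≤-refl (λ p q → ≤-trans q p) (λ k → G (αs k) y)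
                                   G-step z≤n i≤ℓ ⟩
  G (αs 0) y       ≡⟨ cong (λ t → G t y) start-α ⟩
  G α y            ≡⟨ SlowG⇒≡G Gα ⟨
  m                ∎
  where
    open HardyComp hc
    open ≤-Reasoning
    y = ns ℓ
    ns-≤ : ∀ {k} → k ≤ ℓ → ns k ≤ y
    ns-≤ k≤ℓ = steps⇒chain {R = _≤_} ≤-refl ≤-trans ns
      (λ k k<ℓ → subst (ns k ≤_) (sym (step-n k k<ℓ)) (strictlyIncreasing⇒inflationary si (ns k)))
      k≤ℓ ≤-refl
    G-step : ∀ k → k < ℓ → G (αs (suc k)) y ≤ G (αs k) y
    G-step k k<ℓ = <⇒≤ (Pred⇒G< (step-α k k<ℓ) (ns-≤ (<⇒≤ k<ℓ)))
    0<y : 0 < y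
    0<y = <-≤-trans 0<n (subst (_≤ y) start-n (ns-≤ z≤n))
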